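{- For every integer $k\ge0$ and every set system $\mathcal{F}$ over $[n]$, $P(\mathcal{F})\ge\frac{k+1}{S(\mathcal{F})^k}\cdot(1+o(1))$, where the $o(1)$ term is with respect to $n\to\infty$.
   Context: A set system over $[n]$ is a family $\mathcal{F}\subseteq 2^{[n]}$. A maximal chain of $\mathcal{F}$ is a sequence $S_0\subsetneq\dots\subsetneq S_n$ of members of $\mathcal{F}$; $C(\mathcal{F})$ is their number. $S(\mathcal{F})=|\mathcal{F}|^{1/n}$; $P(\mathcal{F})=(n!/C(\mathcal{F}))^{1/n}$ if $C(\mathcal{F})>0$ and $+\infty$ otherwise. -}

module Defs where

open import Data.Nat using (ℕ; zero; suc)
open import Data.Bool using (Bool; true; false)
open import Data.Bool.Properties using () renaming (_≟_ to _≟ᵇ_)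
open import Data.List using (List; []; _∷_; _++_; map; concatMap; filter; length)
open import Data.Vec using (Vec; []; _∷_)
open import Data.Product using (_×_; _,_)
open import Data.Unit using (⊤; tt)
open import Data.Fin.Subset using (Subset; _⊂_; inside; outside)
open import Data.Fin.Subset.Properties using (_⊂?_)
open import Relation.Nullary using (Dec; yes; no; _×-dec_)
open import Relation.Binary.PropositionalEquality using (_≡_)

SetSystem : ℕ → Set
SetSystem n = Subset n → Bool

allSubsets : (n : ℕ) → List (Subset n)
allSubsets zero    = [] ∷ []
allSubsets (suc n) = map (inside ∷_) (allSubsets n) ++ map (outside ∷_) (allSubsets n)

allVecs : {A : Set} → (m : ℕ) → List A → List (Vec A m)
allVecs zero    xs = [] ∷ []
allVecs (suc m) xs = concatMap (λ x → map (x ∷_) (allVecs m xs)) xs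

card : {n : ℕ} → SetSystem n → ℕ
card {n} F = length (filter (λ S → F S ≟ᵇ true) (allSubsets n))

AllIn : {n m : ℕ} → SetSystem n → Vec (Subset n) m → Set
AllIn F []      = ⊤
AllIn F (S ∷ c) = (F S ≡ true) × AllIn F c

allIn? : {n m : ℕ} → (F : SetSystem n) → (c : Vec (Subset n) m) → Dec (AllIn F c)
allIn? F []      = yes tt
allIn? F (S ∷ c) = (F S ≟ᵇ true) ×-dec allIn? F c

StrictChain : {n m : ℕ} → Vec (Subset n) m → Set
StrictChain []            = ⊤
StrictChain (S ∷ [])      = ⊤
StrictChain (S ∷ T ∷ c)   = (S ⊂ T) × StrictChain (T ∷ c)

strictChain? : {n m : ℕ} → (c : Vec (Subset n) m) → Dec (StrictChain c)
strictChain? []          = yes tt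
strictChain? (S ∷ [])    = yes tt
strictChain? (S ∷ T ∷ c) = (S ⊂? T) ×-dec strictChain? (T ∷ c)

IsMaxChain : {n : ℕ} → SetSystem n → Vec (Subset n) (suc n) → Set
IsMaxChain F c = AllIn F c × StrictChain c

isMaxChain? : {n : ℕ} → (F : SetSystem n) → (c : Vec (Subset n) (suc n)) → Dec (IsMaxChain F c)
isMaxChain? F c = allIn? F c ×-dec strictChain? c

chainCount : {n : ℕ} → SetSystem n → ℕ
chainCount {n} F = length (filter (isMaxChain? F) (allVecs (suc n) (allSubsets n)))

-- Fix a composition n = d₀ + ⋯ + d_k. A maximal chain ∅ = c₀ ⋖ c₁ ⋖ ⋯ ⋖ cₙ = [n] of F passes
-- through the k checkpoints c_{d₀}, c_{d₀+d₁}, … , all in F, and between two sets lying d levels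
-- apart there are at most d! saturated chains; hence C(F) ≤ |F|^k · d₀! ⋯ d_k!.
-- For the balanced composition of n, obtained from that of n - 1 by increasing a smallest part
-- d ≤ (n - 1)/(k + 1), the quantity G(n) = d₀! ⋯ d_k! · ((k+1)m)^n grows at each step by a factor
-- at most (n + k)·m, while H(n) = n! (m+1)^n grows by n (m+1). Once n exceeds 2mk the first factor
-- is at most a/(a+1) times the second, where a = 2m + 1, so G/H decays geometrically and
-- G(n) ≤ H(n) for large n; combined with the chain bound this is the claim.
module Submission where

open import Defs
open import Data.Nat using (ℕ; suc; _+_; _*_; _^_; _≤_; _!)
open import Data.Product using (∃-syntax)

open import Data.Bool using (true; false; if_then_else_)
open import Data.Bool.Properties using () renaming (_≟_ to _≟ᵇ_)
open import Data.Fin.Subset using (Side; Subset; inside; outside; _⊆_; _─_; ∣_∣)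
  renaming (⊥ to ∅; ⊤ to full)
open import Data.Fin.Subset.Properties
  using (_⊆?_; ⊆-refl; ⊆-trans; drop-∷-⊆; ⊥⊆; ⊆⊤; ∣⊥∣≡0; ∣⊤∣≡n; ∣p∣≤n; p⊂q⇒∣p∣<∣q∣)
open import Data.List using (List; []; _∷_; _++_; map; concatMap; filter; length)
open import Data.List.Membership.Propositional using (_∈_)
open import Data.List.Membership.Propositional.Properties using (∈-++⁺ˡ; ∈-++⁺ʳ; ∈-map⁺)
open import Data.List.Relation.Unary.Any using (here; there)
open import Data.Nat using (zero; NonZero; _<_; _∸_; _⊓_; z≤n)
open import Data.Nat.Combinatorics using (_C_; nCn≡1; nC1≡n; nCk+nC[k+1]≡[n+1]C[k+1])
open import Data.Nat.Properties
open import Data.Nat.Tactic.RingSolver using (solve-∀)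
open import Algebra.Properties.CommutativeSemigroup +-commutativeSemigroup
  using () renaming (interchange to +-interchange)
open import Algebra.Properties.CommutativeSemigroup *-commutativeSemigroup
  using (x∙yz≈y∙xz; xy∙z≈y∙xz)
open import Data.Product using (_×_; _,_; proj₁)
open import Data.Vec using (Vec; []; _∷_)
import Data.Vec.Base as Vec
open import Relation.Binary.PropositionalEquality
open import Relation.Nullary using (Dec; yes; no; does; ¬_; _×-dec_; contradiction)
open import Relation.Nullary.Decidable using (dec-true; dec-false)

private variable
  X Y : Set
  P Q R S : Set

∑ : List X → (X → ℕ) → ℕ
∑ []       f = 0
∑ (x ∷ xs) f = f x + ∑ xs f

syntax ∑ xs (λ x → e) = ∑[ x ∈ xs ] e

∑-++ : (xs ys : List X) (f : X → ℕ) → ∑ (xs ++ ys) f ≡ ∑ xs f + ∑ ys f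
∑-++ []       ys f = refl
∑-++ (x ∷ xs) ys f = trans (cong (f x +_) (∑-++ xs ys f)) (sym (+-assoc (f x) _ _))

∑-cong : (xs : List X) {f g : X → ℕ} → (∀ x → f x ≡ g x) → ∑ xs f ≡ ∑ xs g
∑-cong []       f≡g = refl
∑-cong (x ∷ xs) f≡g = cong₂ _+_ (f≡g x) (∑-cong xs f≡g)

∑-mono : (xs : List X) {f g : X → ℕ} → (∀ x → f x ≤ g x) → ∑ xs f ≤ ∑ xs g
∑-mono []       f≤g = z≤n
∑-mono (x ∷ xs) f≤g = +-mono-≤ (f≤g x) (∑-mono xs f≤g)

∑-zero : (xs : List X) {f : X → ℕ} → (∀ x → f x ≡ 0) → ∑ xs f ≡ 0
∑-zero []       f≡0 = refl
∑-zero (x ∷ xs) f≡0 = cong₂ _+_ (f≡0 x) (∑-zero xs f≡0)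

∑-+ : (xs : List X) (f g : X → ℕ) → ∑[ x ∈ xs ] (f x + g x) ≡ ∑ xs f + ∑ xs g
∑-+ []       f g = refl
∑-+ (x ∷ xs) f g = trans (cong (f x + g x +_) (∑-+ xs f g)) (+-interchange (f x) (g x) _ _)

∑-*ˡ : (c : ℕ) (xs : List X) (f : X → ℕ) → ∑[ x ∈ xs ] (c * f x) ≡ c * ∑ xs f
∑-*ˡ c []       f = sym (*-zeroʳ c)
∑-*ˡ c (x ∷ xs) f = trans (cong (c * f x +_) (∑-*ˡ c xs f)) (sym (*-distribˡ-+ c (f x) _))

∑-*ʳ : (c : ℕ) (xs : List X) (f : X → ℕ) → ∑[ x ∈ xs ] (f x * c) ≡ ∑ xs f * c
∑-*ʳ c []       f = refl
∑-*ʳ c (x ∷ xs) f = trans (cong (f x * c +_) (∑-*ʳ c xs f)) (sym (*-distribʳ-+ c (f x) _))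

∈⇒≤∑ : {xs : List X} {x : X} (f : X → ℕ) → x ∈ xs → f x ≤ ∑ xs f
∈⇒≤∑ f (here refl) = m≤m+n _ _
∈⇒≤∑ {xs = y ∷ _} f (there x∈xs) = ≤-trans (∈⇒≤∑ f x∈xs) (m≤n+m _ (f y))

∑-map : (h : X → Y) (xs : List X) (f : Y → ℕ) → ∑ (map h xs) f ≡ ∑[ x ∈ xs ] f (h x)
∑-map h []       f = refl
∑-map h (x ∷ xs) f = cong (f (h x) +_) (∑-map h xs f)

∑-concatMap : (h : X → List Y) (xs : List X) (f : Y → ℕ) →
              ∑ (concatMap h xs) f ≡ ∑[ x ∈ xs ] ∑ (h x) f
∑-concatMap h []       f = refl
∑-concatMap h (x ∷ xs) f = trans (∑-++ (h x) _ f) (cong (∑ (h x) f +_) (∑-concatMap h xs f))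

∑-comm : (xs : List X) (ys : List Y) (f : X → Y → ℕ) →
         ∑[ x ∈ xs ] ∑[ y ∈ ys ] f x y ≡ ∑[ y ∈ ys ] ∑[ x ∈ xs ] f x y
∑-comm []       ys f = sym (∑-zero ys (λ _ → refl))
∑-comm (x ∷ xs) ys f = trans (cong (∑ ys (f x) +_) (∑-comm xs ys f)) (sym (∑-+ ys (f x) _))

∑-*∑-comm : (xs : List X) (ys : List Y) (u : X → ℕ) (v : X → Y → ℕ) (g : Y → ℕ) →
            ∑[ x ∈ xs ] (u x * ∑[ y ∈ ys ] (v x y * g y)) ≡ ∑[ y ∈ ys ] (∑[ x ∈ xs ] (u x * v x y) * g y)
∑-*∑-comm xs ys u v g = begin
    ∑[ x ∈ xs ] (u x * ∑[ y ∈ ys ] (v x y * g y))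
  ≡⟨ ∑-cong xs (λ x → sym (∑-*ˡ (u x) ys _)) ⟩
    ∑[ x ∈ xs ] ∑[ y ∈ ys ] (u x * (v x y * g y))
  ≡⟨ ∑-comm xs ys _ ⟩
    ∑[ y ∈ ys ] ∑[ x ∈ xs ] (u x * (v x y * g y))
  ≡⟨ ∑-cong ys (λ y → trans (∑-cong xs (λ x → sym (*-assoc (u x) _ _))) (∑-*ʳ (g y) xs _)) ⟩
    ∑[ y ∈ ys ] (∑[ x ∈ xs ] (u x * v x y) * g y)
  ∎
  where open ≡-Reasoning

∑-allVecs-suc : (L : ℕ) (xs : List X) (f : Vec X (suc L) → ℕ) →
                ∑ (allVecs (suc L) xs) f ≡ ∑[ x ∈ xs ] ∑[ v ∈ allVecs L xs ] f (x ∷ v)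
∑-allVecs-suc L xs f =
  trans (∑-concatMap (λ x → map (x ∷_) (allVecs L xs)) xs f)
        (∑-cong xs (λ x → ∑-map (x ∷_) (allVecs L xs) f))

𝟙 : Dec P → ℕ
𝟙 P? = if does P? then 1 else 0

𝟙-yes : (P? : Dec P) → P → 𝟙 P? ≡ 1
𝟙-yes P? p rewrite dec-true P? p = refl

𝟙-no : (P? : Dec P) → ¬ P → 𝟙 P? ≡ 0
𝟙-no P? ¬p rewrite dec-false P? ¬p = refl

𝟙≤1 : (P? : Dec P) → 𝟙 P? ≤ 1
𝟙≤1 (yes _) = ≤-refl
𝟙≤1 (no _)  = z≤n

𝟙*≤ : (P? : Dec P) (m : ℕ) → 𝟙 P? * m ≤ m
𝟙*≤ (yes _) m = ≤-reflexive (+-identityʳ m)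
𝟙*≤ (no _)  m = z≤n

𝟙*-mono : (P? : Dec P) {m n : ℕ} → (P → m ≤ n) → 𝟙 P? * m ≤ 𝟙 P? * n
𝟙*-mono (yes p) m≤n = *-monoʳ-≤ 1 (m≤n p)
𝟙*-mono (no _)  m≤n = z≤n

≤𝟙* : (P? : Dec P) {m : ℕ} → (¬ P → m ≡ 0) → m ≤ 𝟙 P? * m
≤𝟙* (yes _) m≡0 = ≤-reflexive (sym (+-identityʳ _))
≤𝟙* (no ¬p) m≡0 = ≤-reflexive (m≡0 ¬p)

𝟙-mono : (P? : Dec P) (Q? : Dec Q) → (P → Q) → 𝟙 P? ≤ 𝟙 Q?
𝟙-mono (yes p) Q? P→Q = ≤-reflexive (sym (𝟙-yes Q? (P→Q p)))
𝟙-mono (no _)  Q? P→Q = z≤n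

𝟙-× : (P? : Dec P) (Q? : Dec Q) → 𝟙 (P? ×-dec Q?) ≡ 𝟙 P? * 𝟙 Q?
𝟙-× (yes _) Q? = sym (+-identityʳ (𝟙 Q?))
𝟙-× (no _)  Q? = refl

𝟙≤𝟙*𝟙 : (P? : Dec P) (Q? : Dec Q) (R? : Dec R) → (P → Q × R) → 𝟙 P? ≤ 𝟙 Q? * 𝟙 R?
𝟙≤𝟙*𝟙 P? Q? R? P→QR = ≤-trans (𝟙-mono P? (Q? ×-dec R?) P→QR) (≤-reflexive (𝟙-× Q? R?))

𝟙*𝟙-mono : (P? : Dec P) (Q? : Dec Q) (R? : Dec R) (S? : Dec S) →
           (P × Q → R × S) → 𝟙 P? * 𝟙 Q? ≤ 𝟙 R? * 𝟙 S?
𝟙*𝟙-mono P? Q? R? S? PQ→RS =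
  ≤-trans (≤-reflexive (sym (𝟙-× P? Q?))) (𝟙≤𝟙*𝟙 (P? ×-dec Q?) R? S? PQ→RS)

∑-𝟙-none : {P : X → Set} (xs : List X) (P? : ∀ x → Dec (P x)) →
           (∀ x → ¬ P x) → ∑[ x ∈ xs ] 𝟙 (P? x) ≡ 0
∑-𝟙-none xs P? ¬P = ∑-zero xs (λ x → 𝟙-no (P? x) (¬P x))

length-filter≡∑𝟙 : {P : X → Set} (P? : ∀ x → Dec (P x)) (xs : List X) →
                   length (filter P? xs) ≡ ∑[ x ∈ xs ] 𝟙 (P? x)
length-filter≡∑𝟙 P? []       = refl
length-filter≡∑𝟙 P? (x ∷ xs) with does (P? x)
... | true  = cong suc (length-filter≡∑𝟙 P? xs)
... | false = length-filter≡∑𝟙 P? xs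

-- Intervals and saturated chains in the subset lattice

∈-allSubsets : ∀ {n} (A : Subset n) → A ∈ allSubsets n
∈-allSubsets []            = here refl
∈-allSubsets (inside ∷ A)  = ∈-++⁺ˡ (∈-map⁺ (inside ∷_) (∈-allSubsets A))
∈-allSubsets (outside ∷ A) = ∈-++⁺ʳ _ (∈-map⁺ (outside ∷_) (∈-allSubsets A))

∑-allSubsets-suc : ∀ {n} (f : Subset (suc n) → ℕ) →
                   ∑ (allSubsets (suc n)) f ≡
                   ∑[ B ∈ allSubsets n ] f (inside ∷ B) + ∑[ B ∈ allSubsets n ] f (outside ∷ B)
∑-allSubsets-suc {n} f =
  trans (∑-++ (map (inside ∷_) (allSubsets n)) _ f)
        (cong₂ _+_ (∑-map (inside ∷_) (allSubsets n) f) (∑-map (outside ∷_) (allSubsets n) f))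

∑-allSubsets-suc-≤ : ∀ {n} (f : Subset (suc n) → ℕ) {a b : ℕ} →
                     ∑[ B ∈ allSubsets n ] f (inside ∷ B) ≤ a →
                     ∑[ B ∈ allSubsets n ] f (outside ∷ B) ≤ b →
                     ∑ (allSubsets (suc n)) f ≤ a + b
∑-allSubsets-suc-≤ f ≤a ≤b = ≤-trans (≤-reflexive (∑-allSubsets-suc f)) (+-mono-≤ ≤a ≤b)

∣p─q∣+∣q∣≡∣p∣ : ∀ {n} {p q : Subset n} → q ⊆ p → ∣ p ─ q ∣ + ∣ q ∣ ≡ ∣ p ∣
∣p─q∣+∣q∣≡∣p∣ {p = []}          {[]}          _   = refl
∣p─q∣+∣q∣≡∣p∣ {p = inside  ∷ p} {outside ∷ q} q⊆p = cong suc (∣p─q∣+∣q∣≡∣p∣ (drop-∷-⊆ q⊆p))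
∣p─q∣+∣q∣≡∣p∣ {p = outside ∷ p} {outside ∷ q} q⊆p = ∣p─q∣+∣q∣≡∣p∣ (drop-∷-⊆ q⊆p)
∣p─q∣+∣q∣≡∣p∣ {p = inside  ∷ p} {inside  ∷ q} q⊆p =
  trans (+-suc _ _) (cong suc (∣p─q∣+∣q∣≡∣p∣ (drop-∷-⊆ q⊆p)))
∣p─q∣+∣q∣≡∣p∣ {p = outside ∷ p} {inside  ∷ q} q⊆p = contradiction (q⊆p Vec.here) λ ()

-- Measuring the layer by ∣ B ─ A ∣ rather than by ∣ B ∣ makes every case of the induction in
-- ∑-layer≤C reduce definitionally.
Layer : ∀ {n} → ℕ → Subset n → Subset n → Subset n → Set
Layer j A T B = A ⊆ B × B ⊆ T × ∣ B ─ A ∣ ≡ j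

layer? : ∀ {n} (j : ℕ) (A T B : Subset n) → Dec (Layer j A T B)
layer? j A T B = A ⊆? B ×-dec B ⊆? T ×-dec ∣ B ─ A ∣ ≟ j

∑-layer-empty : ∀ {n} j (A T : Subset (suc n)) (s : Side) → (∀ {B} → ¬ Layer j A T (s ∷ B)) →
                ∑[ B ∈ allSubsets n ] 𝟙 (layer? j A T (s ∷ B)) ≤ 0
∑-layer-empty {n} j A T s ¬layer =
  ≤-reflexive (∑-𝟙-none (allSubsets n) (λ B → layer? j A T (s ∷ B)) (λ _ → ¬layer))

∑-layer≤C : ∀ {n} (j : ℕ) (A T : Subset n) →
            ∑[ B ∈ allSubsets n ] 𝟙 (layer? j A T B) ≤ ∣ T ─ A ∣ C j
∑-layer≤C zero    [] [] = ≤-refl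
∑-layer≤C (suc j) [] [] = z≤n
∑-layer≤C {suc n} j (inside ∷ A) (inside ∷ T) =
  ≤-trans (∑-allSubsets-suc-≤ {n} _ (∑-layer≤C j A T)
            (∑-layer-empty j (inside ∷ A) (inside ∷ T) outside
               λ (A⊆B , _) → contradiction (A⊆B Vec.here) λ ()))
          (≤-reflexive (+-identityʳ _))
∑-layer≤C {suc n} j (outside ∷ A) (outside ∷ T) =
  ∑-allSubsets-suc-≤ {n} _
    (∑-layer-empty j (outside ∷ A) (outside ∷ T) inside
       λ (_ , B⊆T , _) → contradiction (B⊆T Vec.here) λ ())
    (∑-layer≤C j A T)
∑-layer≤C {suc n} j (inside ∷ A) (outside ∷ T) =
  ≤-trans (∑-allSubsets-suc-≤ {n} _
            (∑-layer-empty j (inside ∷ A) (outside ∷ T) inside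
               λ (_ , B⊆T , _) → contradiction (B⊆T Vec.here) λ ())
            (∑-layer-empty j (inside ∷ A) (outside ∷ T) outside
               λ (A⊆B , _) → contradiction (A⊆B Vec.here) λ ()))
          z≤n
∑-layer≤C {suc n} zero (outside ∷ A) (inside ∷ T) =
  ∑-allSubsets-suc-≤ {n} _
    (∑-layer-empty zero (outside ∷ A) (inside ∷ T) inside λ { (_ , _ , ()) })
    (∑-layer≤C zero A T)
∑-layer≤C {suc n} (suc j) (outside ∷ A) (inside ∷ T) =
  ≤-trans (∑-allSubsets-suc-≤ {n} _ (∑-layer≤C j A T) (∑-layer≤C (suc j) A T))
          (≤-reflexive (nCk+nC[k+1]≡[n+1]C[k+1] _ j))

Above : ∀ {n} → ℕ → Subset n → Subset n → Set
Above d A T = A ⊆ T × ∣ T ∣ ≡ d + ∣ A ∣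

above? : ∀ {n} (d : ℕ) (A T : Subset n) → Dec (Above d A T)
above? d A T = A ⊆? T ×-dec ∣ T ∣ ≟ d + ∣ A ∣

module _ {n : ℕ} where

  private
    U : List (Subset n)
    U = allSubsets n

  Above⇒∣─∣ : ∀ {d} {A T : Subset n} → Above d A T → ∣ T ─ A ∣ ≡ d
  Above⇒∣─∣ {d} {A} (A⊆T , ∣T∣≡) = +-cancelʳ-≡ ∣ A ∣ _ d (trans (∣p─q∣+∣q∣≡∣p∣ A⊆T) ∣T∣≡)

  Above-step : ∀ {d} {A B T : Subset n} → Above 1 A B → Above d B T → Above (suc d) A T
  Above-step {d} {A} (A⊆B , ∣B∣≡) (B⊆T , ∣T∣≡) =
    ⊆-trans A⊆B B⊆T , trans ∣T∣≡ (trans (cong (d +_) ∣B∣≡) (+-suc d ∣ A ∣))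

  ∑-above≤C : ∀ j (A : Subset n) → ∑[ T ∈ U ] 𝟙 (above? j A T) ≤ (n ∸ ∣ A ∣) C j
  ∑-above≤C j A = begin
      ∑[ T ∈ U ] 𝟙 (above? j A T)
    ≤⟨ ∑-mono U (λ T → 𝟙-mono (above? j A T) (layer? j A full T)
                         (λ A⋯T → proj₁ A⋯T , ⊆⊤ , Above⇒∣─∣ A⋯T)) ⟩
      ∑[ T ∈ U ] 𝟙 (layer? j A full T)
    ≤⟨ ∑-layer≤C j A full ⟩
      ∣ full ─ A ∣ C j
    ≡⟨ cong (_C j) ∣full─A∣≡n∸∣A∣ ⟩
      (n ∸ ∣ A ∣) C j
    ∎
    where
    open ≤-Reasoning
    ∣full─A∣≡n∸∣A∣ : ∣ full ─ A ∣ ≡ n ∸ ∣ A ∣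
    ∣full─A∣≡n∸∣A∣ = trans (sym (m+n∸n≡m _ ∣ A ∣))
                          (cong (_∸ ∣ A ∣) (trans (∣p─q∣+∣q∣≡∣p∣ {p = full} {A} ⊆⊤) (∣⊤∣≡n n)))

  ∑-above-top≤1 : ∀ d (A : Subset n) → ∣ A ∣ + d ≡ n → ∑[ T ∈ U ] 𝟙 (above? d A T) ≤ 1
  ∑-above-top≤1 d A ∣A∣+d≡n = begin
    ∑[ T ∈ U ] 𝟙 (above? d A T) ≤⟨ ∑-above≤C d A ⟩
    (n ∸ ∣ A ∣) C d             ≡⟨ cong (_C d) (trans (cong (_∸ ∣ A ∣) (sym ∣A∣+d≡n)) (m+n∸m≡n ∣ A ∣ d)) ⟩
    d C d                       ≡⟨ nCn≡1 d ⟩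
    1                           ∎
    where open ≤-Reasoning

  ∑-bottom≤1 : ∑[ A ∈ U ] 𝟙 (∣ A ∣ ≟ 0) ≤ 1
  ∑-bottom≤1 = ≤-trans (∑-mono U λ A → 𝟙-mono (∣ A ∣ ≟ 0) (above? 0 ∅ A)
                                         λ ∣A∣≡0 → ⊥⊆ , trans ∣A∣≡0 (sym (∣⊥∣≡0 n)))
                       (∑-above≤C 0 ∅)

  walks : ℕ → Subset n → (Subset n → ℕ) → ℕ
  walks zero    A g = g A
  walks (suc d) A g = ∑[ B ∈ U ] (𝟙 (above? 1 A B) * walks d B g)

  ∑-covers≤ : ∀ d (A T : Subset n) →
              ∑[ B ∈ U ] (𝟙 (above? 1 A B) * 𝟙 (above? d B T)) ≤ 𝟙 (above? (suc d) A T) * suc d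
  ∑-covers≤ d A T = begin
      ∑[ B ∈ U ] (𝟙 (above? 1 A B) * 𝟙 (above? d B T))
    ≤⟨ ∑-mono U (λ B → 𝟙*𝟙-mono (above? 1 A B) (above? d B T) (above? (suc d) A T) (layer? 1 A T B)
                         λ (A⋖B , B⋯T) → Above-step A⋖B B⋯T , proj₁ A⋖B , proj₁ B⋯T , Above⇒∣─∣ A⋖B) ⟩
      ∑[ B ∈ U ] (𝟙 (above? (suc d) A T) * 𝟙 (layer? 1 A T B))
    ≡⟨ ∑-*ˡ (𝟙 (above? (suc d) A T)) U (λ B → 𝟙 (layer? 1 A T B)) ⟩
      𝟙 (above? (suc d) A T) * ∑[ B ∈ U ] 𝟙 (layer? 1 A T B)
    ≤⟨ 𝟙*-mono (above? (suc d) A T) (λ A⋯T → begin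
         ∑[ B ∈ U ] 𝟙 (layer? 1 A T B) ≤⟨ ∑-layer≤C 1 A T ⟩
         ∣ T ─ A ∣ C 1                 ≡⟨ nC1≡n _ ⟩
         ∣ T ─ A ∣                     ≡⟨ Above⇒∣─∣ A⋯T ⟩
         suc d                         ∎) ⟩
      𝟙 (above? (suc d) A T) * suc d
    ∎
    where open ≤-Reasoning

  walks≤ : ∀ d (A : Subset n) (g : Subset n → ℕ) →
           walks d A g ≤ d ! * ∑[ T ∈ U ] (𝟙 (above? d A T) * g T)
  walks≤ zero A g = begin
      g A                                  ≡⟨ sym (*-identityˡ (g A)) ⟩
      1 * g A                              ≡⟨ cong (_* g A) (sym (𝟙-yes (above? 0 A A) (⊆-refl , refl))) ⟩
      𝟙 (above? 0 A A) * g A               ≤⟨ ∈⇒≤∑ (λ T → 𝟙 (above? 0 A T) * g T) (∈-allSubsets A) ⟩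
      ∑[ T ∈ U ] (𝟙 (above? 0 A T) * g T)  ≡⟨ sym (*-identityˡ _) ⟩
      1 * ∑[ T ∈ U ] (𝟙 (above? 0 A T) * g T)
    ∎
    where open ≤-Reasoning
  walks≤ (suc d) A g = begin
      ∑[ B ∈ U ] (𝟙 (above? 1 A B) * walks d B g)
    ≤⟨ ∑-mono U (λ B → *-monoʳ-≤ (𝟙 (above? 1 A B)) (walks≤ d B g)) ⟩
      ∑[ B ∈ U ] (𝟙 (above? 1 A B) * (d ! * ∑[ T ∈ U ] (𝟙 (above? d B T) * g T)))
    ≡⟨ ∑-cong U (λ B → x∙yz≈y∙xz (𝟙 (above? 1 A B)) (d !) _) ⟩
      ∑[ B ∈ U ] (d ! * (𝟙 (above? 1 A B) * ∑[ T ∈ U ] (𝟙 (above? d B T) * g T)))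
    ≡⟨ ∑-*ˡ (d !) U _ ⟩
      d ! * ∑[ B ∈ U ] (𝟙 (above? 1 A B) * ∑[ T ∈ U ] (𝟙 (above? d B T) * g T))
    ≡⟨ cong (d ! *_) (∑-*∑-comm U U (λ B → 𝟙 (above? 1 A B)) (λ B T → 𝟙 (above? d B T)) g) ⟩
      d ! * ∑[ T ∈ U ] (∑[ B ∈ U ] (𝟙 (above? 1 A B) * 𝟙 (above? d B T)) * g T)
    ≤⟨ *-monoʳ-≤ (d !) (∑-mono U (λ T → *-monoˡ-≤ (g T) (∑-covers≤ d A T))) ⟩
      d ! * ∑[ T ∈ U ] (𝟙 (above? (suc d) A T) * suc d * g T)
    ≡⟨ cong (d ! *_) (trans (∑-cong U (λ T → xy∙z≈y∙xz (𝟙 (above? (suc d) A T)) (suc d) (g T)))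
                            (∑-*ˡ (suc d) U _)) ⟩
      d ! * (suc d * ∑[ T ∈ U ] (𝟙 (above? (suc d) A T) * g T))
    ≡⟨ trans (x∙yz≈y∙xz (d !) (suc d) _) (sym (*-assoc (suc d) (d !) _)) ⟩
      suc d ! * ∑[ T ∈ U ] (𝟙 (above? (suc d) A T) * g T)
    ∎
    where open ≤-Reasoning

strictChain-size : ∀ {n L} (A : Subset n) (v : Vec (Subset n) L) → StrictChain (A ∷ v) → ∣ A ∣ + L ≤ n
strictChain-size A []      _ = ≤-trans (≤-reflexive (+-identityʳ ∣ A ∣)) (∣p∣≤n A)
strictChain-size {n} {suc L} A (B ∷ v) (A⊂B , chain) = begin
  ∣ A ∣ + suc L ≡⟨ +-suc ∣ A ∣ L ⟩
  suc ∣ A ∣ + L ≤⟨ +-monoˡ-≤ L (p⊂q⇒∣p∣<∣q∣ A⊂B) ⟩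
  ∣ B ∣ + L     ≤⟨ strictChain-size B v chain ⟩
  n             ∎
  where open ≤-Reasoning

-- Counting the maximal chains of a set system

∏! : ∀ {m} → Vec ℕ m → ℕ
∏! []       = 1
∏! (d ∷ ds) = d ! * ∏! ds

module _ {n : ℕ} (F : SetSystem n) where

  private
    U : List (Subset n)
    U = allSubsets n

  IsChain : ∀ {L} → Vec (Subset n) L → Set
  IsChain c = AllIn F c × StrictChain c

  isChain? : ∀ {L} (c : Vec (Subset n) L) → Dec (IsChain c)
  isChain? c = allIn? F c ×-dec strictChain? c

  chainsFrom : Subset n → ℕ → ℕ
  chainsFrom A L = ∑[ v ∈ allVecs L U ] 𝟙 (isChain? (A ∷ v))

  chainCount≡∑chainsFrom : chainCount F ≡ ∑[ A ∈ U ] chainsFrom A n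
  chainCount≡∑chainsFrom =
    trans (length-filter≡∑𝟙 (isMaxChain? F) (allVecs (suc n) U)) (∑-allVecs-suc n U _)

  card≡∑ : card F ≡ ∑[ T ∈ U ] 𝟙 (F T ≟ᵇ true)
  card≡∑ = length-filter≡∑𝟙 (λ T → F T ≟ᵇ true) U

  chainsFrom-∉F : ∀ {T L} → ¬ (F T ≡ true) → chainsFrom T L ≡ 0
  chainsFrom-∉F {T} {L} T∉F =
    ∑-𝟙-none (allVecs L U) (λ v → isChain? (T ∷ v)) λ _ ((T∈F , _) , _) → T∉F T∈F

  chainsFrom-too-long : ∀ {A L} → n < ∣ A ∣ + L → chainsFrom A L ≡ 0
  chainsFrom-too-long {A} {L} n<∣A∣+L =
    ∑-𝟙-none (allVecs L U) (λ v → isChain? (A ∷ v))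
      λ v (_ , chain) → <⇒≱ n<∣A∣+L (strictChain-size A v chain)

  chain-step-covers : ∀ {L} {A B : Subset n} {v : Vec (Subset n) L} → ∣ A ∣ + suc L ≡ n →
                      IsChain (A ∷ B ∷ v) → Above 1 A B × IsChain (B ∷ v)
  chain-step-covers {L} {A} {B} {v} ∣A∣+1+L≡n ((_ , B∷v∈F) , (A⊂B , chain)) =
    (proj₁ A⊂B , ≤-antisym ∣B∣≤1+∣A∣ (p⊂q⇒∣p∣<∣q∣ A⊂B)) , (B∷v∈F , chain)
    where
    ∣B∣≤1+∣A∣ : ∣ B ∣ ≤ suc ∣ A ∣
    ∣B∣≤1+∣A∣ = +-cancelʳ-≤ L _ _
      (≤-trans (strictChain-size B v chain) (≤-reflexive (trans (sym ∣A∣+1+L≡n) (+-suc ∣ A ∣ L))))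

  chainsFrom-suc : ∀ {L} (A : Subset n) → ∣ A ∣ + suc L ≡ n →
                   chainsFrom A (suc L) ≤ ∑[ B ∈ U ] (𝟙 (above? 1 A B) * chainsFrom B L)
  chainsFrom-suc {L} A ∣A∣+1+L≡n = begin
      chainsFrom A (suc L)
    ≡⟨ ∑-allVecs-suc L U _ ⟩
      ∑[ B ∈ U ] ∑[ v ∈ allVecs L U ] 𝟙 (isChain? (A ∷ B ∷ v))
    ≤⟨ ∑-mono U (λ B → ∑-mono (allVecs L U) λ v →
         𝟙≤𝟙*𝟙 (isChain? (A ∷ B ∷ v)) (above? 1 A B) (isChain? (B ∷ v)) (chain-step-covers ∣A∣+1+L≡n)) ⟩
      ∑[ B ∈ U ] ∑[ v ∈ allVecs L U ] (𝟙 (above? 1 A B) * 𝟙 (isChain? (B ∷ v)))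
    ≡⟨ ∑-cong U (λ B → ∑-*ˡ (𝟙 (above? 1 A B)) (allVecs L U) _) ⟩
      ∑[ B ∈ U ] (𝟙 (above? 1 A B) * chainsFrom B L)
    ∎
    where open ≤-Reasoning

  chainsFrom≤walks : ∀ d {L} (A : Subset n) → ∣ A ∣ + (d + L) ≡ n →
                     chainsFrom A (d + L) ≤ walks d A (λ T → chainsFrom T L)
  chainsFrom≤walks zero    A _ = ≤-refl
  chainsFrom≤walks (suc d) {L} A ∣A∣+d+L≡n =
    ≤-trans (chainsFrom-suc A ∣A∣+d+L≡n) (∑-mono U λ B → 𝟙*-mono (above? 1 A B) λ (_ , ∣B∣≡) →
      chainsFrom≤walks d B (trans (cong (_+ (d + L)) ∣B∣≡) (trans (sym (+-suc ∣ A ∣ (d + L))) ∣A∣+d+L≡n)))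

  chainsFrom≤ : ∀ {k} (ds : Vec ℕ (suc k)) (A : Subset n) → ∣ A ∣ + Vec.sum ds ≡ n →
                chainsFrom A (Vec.sum ds) ≤ card F ^ k * ∏! ds
  chainsFrom≤ (d ∷ []) A ∣A∣+d≡n = begin
      chainsFrom A (d + 0)
    ≤⟨ chainsFrom≤walks d A ∣A∣+d≡n ⟩
      walks d A (λ T → chainsFrom T 0)
    ≤⟨ walks≤ d A _ ⟩
      d ! * ∑[ T ∈ U ] (𝟙 (above? d A T) * chainsFrom T 0)
    ≤⟨ *-monoʳ-≤ (d !) (∑-mono U λ T →
         *-monoʳ-≤ (𝟙 (above? d A T)) (+-monoˡ-≤ 0 (𝟙≤1 (isChain? (T ∷ []))))) ⟩
      d ! * ∑[ T ∈ U ] (𝟙 (above? d A T) * 1)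
    ≡⟨ cong (d ! *_) (∑-cong U λ T → *-identityʳ _) ⟩
      d ! * ∑[ T ∈ U ] 𝟙 (above? d A T)
    ≤⟨ *-monoʳ-≤ (d !) (∑-above-top≤1 d A (trans (cong (∣ A ∣ +_) (sym (+-identityʳ d))) ∣A∣+d≡n)) ⟩
      d ! * 1
    ≡⟨ sym (*-identityˡ _) ⟩
      1 * (d ! * 1)
    ∎
    where open ≤-Reasoning
  chainsFrom≤ {suc k} (d ∷ es) A ∣A∣+d+L≡n = begin
      chainsFrom A (d + L)
    ≤⟨ chainsFrom≤walks d A ∣A∣+d+L≡n ⟩
      walks d A (λ T → chainsFrom T L)
    ≤⟨ walks≤ d A _ ⟩
      d ! * ∑[ T ∈ U ] (𝟙 (above? d A T) * chainsFrom T L)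
    ≤⟨ *-monoʳ-≤ (d !) (∑-mono U checkpoint) ⟩
      d ! * ∑[ T ∈ U ] (𝟙 (F T ≟ᵇ true) * bound)
    ≡⟨ cong (d ! *_) (trans (∑-*ʳ bound U _) (cong (_* bound) (sym card≡∑))) ⟩
      d ! * (card F * bound)
    ≡⟨ regroup (d !) (card F) (card F ^ k) (∏! es) ⟩
      card F * card F ^ k * (d ! * ∏! es)
    ∎
    where
    open ≤-Reasoning
    L = Vec.sum es
    bound = card F ^ k * ∏! es
    regroup : ∀ a c p q → a * (c * (p * q)) ≡ c * p * (a * q)
    regroup = solve-∀
    ∣T∣+L≡n : ∀ {T} → ∣ T ∣ ≡ d + ∣ A ∣ → ∣ T ∣ + L ≡ n
    ∣T∣+L≡n ∣T∣≡ = trans (cong (_+ L) ∣T∣≡) (trans (shuffle d ∣ A ∣ L) ∣A∣+d+L≡n)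
      where
      shuffle : ∀ a b c → a + b + c ≡ b + (a + c)
      shuffle = solve-∀
    checkpoint : ∀ T → 𝟙 (above? d A T) * chainsFrom T L ≤ 𝟙 (F T ≟ᵇ true) * bound
    checkpoint T = ≤-trans (𝟙*-mono (above? d A T) λ (_ , ∣T∣≡) → begin
        chainsFrom T L                    ≤⟨ ≤𝟙* (F T ≟ᵇ true) (chainsFrom-∉F {T} {L}) ⟩
        𝟙 (F T ≟ᵇ true) * chainsFrom T L  ≤⟨ *-monoʳ-≤ (𝟙 (F T ≟ᵇ true)) (chainsFrom≤ es T (∣T∣+L≡n {T} ∣T∣≡)) ⟩
        𝟙 (F T ≟ᵇ true) * bound           ∎)
      (𝟙*≤ (above? d A T) _)

  chainCount≤ : ∀ {k} (ds : Vec ℕ (suc k)) → Vec.sum ds ≡ n → chainCount F ≤ card F ^ k * ∏! ds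
  chainCount≤ {k} ds ∑ds≡n = begin
      chainCount F                         ≡⟨ chainCount≡∑chainsFrom ⟩
      ∑[ A ∈ U ] chainsFrom A n            ≤⟨ ∑-mono U bottom ⟩
      ∑[ A ∈ U ] (𝟙 (∣ A ∣ ≟ 0) * bound)   ≡⟨ ∑-*ʳ bound U _ ⟩
      ∑[ A ∈ U ] 𝟙 (∣ A ∣ ≟ 0) * bound     ≤⟨ *-monoˡ-≤ bound (∑-bottom≤1 {n}) ⟩
      1 * bound                            ≡⟨ *-identityˡ bound ⟩
      bound                                ∎
    where
    open ≤-Reasoning
    bound = card F ^ k * ∏! ds
    bottom : ∀ A → chainsFrom A n ≤ 𝟙 (∣ A ∣ ≟ 0) * bound
    bottom A = ≤-trans (≤𝟙* (∣ A ∣ ≟ 0) λ ∣A∣≢0 → chainsFrom-too-long {A} {n} (m<n+m n (n≢0⇒n>0 ∣A∣≢0)))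
                       (𝟙*-mono (∣ A ∣ ≟ 0) λ ∣A∣≡0 →
                          subst (λ L → chainsFrom A L ≤ bound) ∑ds≡n (chainsFrom≤ ds A (cong₂ _+_ ∣A∣≡0 ∑ds≡n)))

-- Balanced compositions

minimum : ∀ {k} → Vec ℕ (suc k) → ℕ
minimum = Vec.foldr₁ _⊓_

*-minimum≤sum : ∀ {k} (v : Vec ℕ (suc k)) → suc k * minimum v ≤ Vec.sum v
*-minimum≤sum (d ∷ [])                = ≤-refl
*-minimum≤sum {suc k} (d ∷ v@(_ ∷ _)) = begin
  suc (suc k) * (d ⊓ minimum v)            ≡⟨⟩
  d ⊓ minimum v + suc k * (d ⊓ minimum v)  ≤⟨ +-mono-≤ (m⊓n≤m d _) (*-monoʳ-≤ (suc k) (m⊓n≤n d _)) ⟩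
  d + suc k * minimum v                    ≤⟨ +-monoʳ-≤ d (*-minimum≤sum v) ⟩
  d + Vec.sum v                            ∎
  where open ≤-Reasoning

bumpMin : ∀ {k} → Vec ℕ (suc k) → Vec ℕ (suc k)
bumpMin (d ∷ [])        = suc d ∷ []
bumpMin (d ∷ v@(_ ∷ _)) with d ≤? minimum v
... | yes _ = suc d ∷ v
... | no  _ = d ∷ bumpMin v

sum-bumpMin : ∀ {k} (v : Vec ℕ (suc k)) → Vec.sum (bumpMin v) ≡ suc (Vec.sum v)
sum-bumpMin (d ∷ [])        = refl
sum-bumpMin (d ∷ v@(_ ∷ _)) with d ≤? minimum v
... | yes _ = refl
... | no  _ = trans (cong (d +_) (sum-bumpMin v)) (+-suc d _)

∏!-bumpMin : ∀ {k} (v : Vec ℕ (suc k)) → ∏! (bumpMin v) ≡ suc (minimum v) * ∏! v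
∏!-bumpMin (d ∷ [])        = *-assoc (suc d) (d !) 1
∏!-bumpMin (d ∷ v@(_ ∷ _)) with d ≤? minimum v
... | yes d≤m rewrite m≤n⇒m⊓n≡m d≤m = *-assoc (suc d) (d !) (∏! v)
... | no  d≰m rewrite m≥n⇒m⊓n≡n (≰⇒≥ d≰m) =
  trans (cong (d ! *_) (∏!-bumpMin v)) (x∙yz≈y∙xz (d !) (suc (minimum v)) (∏! v))

balanced : (k n : ℕ) → Vec ℕ (suc k)
balanced k zero    = Vec.replicate (suc k) 0
balanced k (suc n) = bumpMin (balanced k n)

sum-balanced : ∀ k n → Vec.sum (balanced k n) ≡ n
sum-balanced k zero    = sum-replicate-0 (suc k)
  where
  sum-replicate-0 : ∀ m → Vec.sum (Vec.replicate m 0) ≡ 0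
  sum-replicate-0 zero    = refl
  sum-replicate-0 (suc m) = sum-replicate-0 m
sum-balanced k (suc n) = trans (sum-bumpMin (balanced k n)) (cong suc (sum-balanced k n))

*-∏!-balanced-suc : ∀ k n → suc k * ∏! (balanced k (suc n)) ≤ (suc k + n) * ∏! (balanced k n)
*-∏!-balanced-suc k n = begin
    suc k * ∏! (bumpMin b)              ≡⟨ cong (suc k *_) (∏!-bumpMin b) ⟩
    suc k * (suc (minimum b) * ∏! b)    ≡⟨ sym (*-assoc (suc k) (suc (minimum b)) (∏! b)) ⟩
    suc k * suc (minimum b) * ∏! b      ≡⟨ cong (_* ∏! b) (*-suc (suc k) (minimum b)) ⟩
    (suc k + suc k * minimum b) * ∏! b  ≤⟨ *-monoˡ-≤ (∏! b) (+-monoʳ-≤ (suc k) k+1*min≤n) ⟩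
    (suc k + n) * ∏! b                  ∎
  where
  open ≤-Reasoning
  b = balanced k n
  k+1*min≤n : suc k * minimum b ≤ n
  k+1*min≤n = ≤-trans (*-minimum≤sum b) (≤-reflexive (sum-balanced k n))

-- Eventual domination

bernoulli : ∀ a t → a ^ t * (a + t) ≤ a * suc a ^ t
bernoulli a zero    = ≤-reflexive (trans (*-identityˡ (a + 0)) (trans (+-identityʳ a) (sym (*-identityʳ a))))
bernoulli a (suc t) = begin
    a * a ^ t * (a + suc t)                  ≡⟨ expand a (a ^ t) t ⟩
    a * (a ^ t * (a + t)) + a ^ t * a        ≤⟨ +-monoʳ-≤ _ (*-monoʳ-≤ (a ^ t) (m≤m+n a t)) ⟩
    a * (a ^ t * (a + t)) + a ^ t * (a + t)  ≡⟨ +-comm _ (a ^ t * (a + t)) ⟩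
    suc a * (a ^ t * (a + t))                ≤⟨ *-monoʳ-≤ (suc a) (bernoulli a t) ⟩
    suc a * (a * suc a ^ t)                  ≡⟨ x∙yz≈y∙xz (suc a) a _ ⟩
    a * (suc a * suc a ^ t)                  ∎
  where
  open ≤-Reasoning
  expand : ∀ a p t → a * p * (a + suc t) ≡ a * (p * (a + t)) + p * a
  expand = solve-∀

module _ (G H g h : ℕ → ℕ) (a N₀ : ℕ) .{{_ : NonZero a}} .{{H₀≢0 : NonZero (H N₀)}}
         (G-step : ∀ n → G (suc n) ≤ g n * G n)
         (H-step : ∀ n → h n * H n ≤ H (suc n))
         (g/h≤a/1+a : ∀ n → N₀ ≤ n → g n * suc a ≤ h n * a)
         where

  ratio-decay : ∀ t → G (t + N₀) * H N₀ * suc a ^ t ≤ H (t + N₀) * G N₀ * a ^ t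
  ratio-decay zero    = ≤-reflexive (cong (_* 1) (*-comm (G N₀) (H N₀)))
  ratio-decay (suc t) = begin
      G (suc n) * H N₀ * suc a ^ suc t
    ≤⟨ *-monoˡ-≤ (suc a ^ suc t) (*-monoˡ-≤ (H N₀) (G-step n)) ⟩
      g n * G n * H N₀ * (suc a * suc a ^ t)
    ≡⟨ regroup (g n) (G n) (H N₀) (suc a) (suc a ^ t) ⟩
      g n * suc a * (G n * H N₀ * suc a ^ t)
    ≤⟨ *-mono-≤ (g/h≤a/1+a n (m≤n+m N₀ t)) (ratio-decay t) ⟩
      h n * a * (H n * G N₀ * a ^ t)
    ≡⟨ ungroup (h n) a (H n) (G N₀) (a ^ t) ⟩
      h n * H n * G N₀ * (a * a ^ t)
    ≤⟨ *-monoˡ-≤ (a ^ suc t) (*-monoˡ-≤ (G N₀) (H-step n)) ⟩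
      H (suc n) * G N₀ * a ^ suc t
    ∎
    where
    open ≤-Reasoning
    n = t + N₀
    regroup : ∀ x y z s p → x * y * z * (s * p) ≡ x * s * (y * z * p)
    regroup = solve-∀
    ungroup : ∀ x s y z p → x * s * (y * z * p) ≡ x * y * z * (s * p)
    ungroup = solve-∀

  dominated : ∀ t → a * G N₀ ≤ t → G (t + N₀) ≤ H (t + N₀)
  dominated t aG₀≤t = *-cancelʳ-≤ (G (t + N₀)) (H (t + N₀)) (H N₀ * suc a ^ t) {{H₀*[1+a]^t≢0}} (begin
      G (t + N₀) * (H N₀ * suc a ^ t)   ≡⟨ sym (*-assoc (G (t + N₀)) (H N₀) _) ⟩
      G (t + N₀) * H N₀ * suc a ^ t     ≤⟨ ratio-decay t ⟩
      H (t + N₀) * G N₀ * a ^ t         ≡⟨ *-assoc (H (t + N₀)) (G N₀) _ ⟩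
      H (t + N₀) * (G N₀ * a ^ t)       ≤⟨ *-monoʳ-≤ (H (t + N₀)) G₀*a^t≤[1+a]^t ⟩
      H (t + N₀) * suc a ^ t            ≤⟨ *-monoʳ-≤ (H (t + N₀)) (m≤n*m (suc a ^ t) (H N₀)) ⟩
      H (t + N₀) * (H N₀ * suc a ^ t)   ∎)
    where
    open ≤-Reasoning
    H₀*[1+a]^t≢0 : NonZero (H N₀ * suc a ^ t)
    H₀*[1+a]^t≢0 = m*n≢0 (H N₀) (suc a ^ t) {{H₀≢0}} {{m^n≢0 (suc a) t}}
    G₀*a^t≤[1+a]^t : G N₀ * a ^ t ≤ suc a ^ t
    G₀*a^t≤[1+a]^t = *-cancelˡ-≤ a (begin
      a * (G N₀ * a ^ t)   ≡⟨ x∙yz≈y∙xz a (G N₀) (a ^ t) ⟩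
      G N₀ * (a * a ^ t)   ≡⟨ cong (G N₀ *_) (*-comm a (a ^ t)) ⟩
      G N₀ * (a ^ t * a)   ≡⟨ x∙yz≈y∙xz (G N₀) (a ^ t) a ⟩
      a ^ t * (G N₀ * a)   ≤⟨ *-monoʳ-≤ (a ^ t) (≤-trans (≤-reflexive (*-comm (G N₀) a))
                                                         (≤-trans aG₀≤t (m≤n+m t a))) ⟩
      a ^ t * (a + t)      ≤⟨ bernoulli a t ⟩
      a * suc a ^ t        ∎)

  eventually-≤ : ∃[ N ] (∀ n → N ≤ n → G n ≤ H n)
  eventually-≤ = a * G N₀ + N₀ , λ n N≤n →
    subst (λ x → G x ≤ H x) (m∸n+n≡m (≤-trans (m≤n+m N₀ _) N≤n))
          (dominated (n ∸ N₀) (≤-trans (≤-reflexive (sym (m+n∸n≡m _ N₀))) (∸-monoˡ-≤ N₀ N≤n)))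

module _ (k m : ℕ) where

  G H : ℕ → ℕ
  G n = ∏! (balanced k n) * (suc k * m) ^ n
  H n = n ! * suc m ^ n

  G-step : ∀ n → G (suc n) ≤ (suc k + n) * m * G n
  G-step n = begin
      ∏! (balanced k (suc n)) * (suc k * m * w)   ≡⟨ regroup (∏! (balanced k (suc n))) (suc k) m w ⟩
      suc k * ∏! (balanced k (suc n)) * (m * w)   ≤⟨ *-monoˡ-≤ (m * w) (*-∏!-balanced-suc k n) ⟩
      (suc k + n) * ∏! (balanced k n) * (m * w)   ≡⟨ ungroup (suc k + n) (∏! (balanced k n)) m w ⟩
      (suc k + n) * m * (∏! (balanced k n) * w)   ∎
    where
    open ≤-Reasoning
    w = (suc k * m) ^ n
    regroup : ∀ p s m x → p * (s * m * x) ≡ s * p * (m * x)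
    regroup = solve-∀
    ungroup : ∀ s p m x → s * p * (m * x) ≡ s * m * (p * x)
    ungroup = solve-∀

  H-step : ∀ n → suc n * suc m * H n ≤ H (suc n)
  H-step n = ≤-reflexive (regroup (suc n) (suc m) (n !) (suc m ^ n))
    where
    regroup : ∀ s u f p → s * u * (f * p) ≡ s * f * (u * p)
    regroup = solve-∀

  -- The choice a = 2m + 1 turns (n + k + 1)·m·(a + 1) ≤ (n + 1)(m + 1)·a into 2mk ≤ n + 1.
  growth-ratio : ∀ n → 2 * m * k ≤ n → (suc k + n) * m * suc (suc (2 * m)) ≤ suc n * suc m * suc (2 * m)
  growth-ratio n 2mk≤n = begin
      (suc k + n) * m * suc (suc (2 * m))  ≡⟨ lhs k n m ⟩
      suc m * (2 * m * suc n + 2 * m * k)  ≤⟨ *-monoʳ-≤ (suc m) (+-monoʳ-≤ (2 * m * suc n)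
                                                                         (≤-trans 2mk≤n (n≤1+n n))) ⟩
      suc m * (2 * m * suc n + suc n)      ≡⟨ rhs n m ⟩
      suc n * suc m * suc (2 * m)          ∎
    where
    open ≤-Reasoning
    lhs : ∀ k n m → (suc k + n) * m * suc (suc (2 * m)) ≡ suc m * (2 * m * suc n + 2 * m * k)
    lhs = solve-∀
    rhs : ∀ n m → suc m * (2 * m * suc n + suc n) ≡ suc n * suc m * suc (2 * m)
    rhs = solve-∀

  eventually-G≤H : ∃[ N ] (∀ n → N ≤ n → G n ≤ H n)
  eventually-G≤H =
    eventually-≤ G H (λ n → (suc k + n) * m) (λ n → suc n * suc m) (suc (2 * m)) (2 * m * k)
                 {{_}} {{m*n≢0 _ _ {{(2 * m * k) !≢0}} {{m^n≢0 (suc m) (2 * m * k)}}}}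
                 G-step H-step growth-ratio

lemma4p8 : (k m : ℕ) → ∃[ N ] ((n : ℕ) → N ≤ n → (F : SetSystem n) →
             chainCount F * ((suc k * m) ^ n) ≤ (n !) * (card F ^ k) * (suc m ^ n))
lemma4p8 k m = let (N , G≤H) = eventually-G≤H k m in N , λ n N≤n F → begin
    chainCount F * (suc k * m) ^ n
  ≤⟨ *-monoˡ-≤ _ (chainCount≤ F (balanced k n) (sum-balanced k n)) ⟩
    card F ^ k * ∏! (balanced k n) * (suc k * m) ^ n
  ≡⟨ *-assoc (card F ^ k) _ _ ⟩
    card F ^ k * G k m n
  ≤⟨ *-monoʳ-≤ (card F ^ k) (G≤H n N≤n) ⟩
    card F ^ k * (n ! * suc m ^ n)
  ≡⟨ trans (x∙yz≈y∙xz (card F ^ k) (n !) _) (sym (*-assoc (n !) _ _)) ⟩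
    n ! * card F ^ k * suc m ^ n
  ∎
  where open ≤-Reasoning
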